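{- Let $S=\prod_i!\alpha_i.S_i$ be a seed whose parallel components are all replicated. (i) If $F$ is a finite process and $S|F$ is a seed, then $S\mathrel{\#}F$. (ii) If $R$ is a finite process with $S\rightsquigarrow R$, then $S\mathrel{\#}R$.
   Context: Fix a countable set of actions. Finite processes: $F ::= 0 \mid \alpha.F \mid F|F$. Processes: $P ::= F \mid\ !\alpha.F \mid P|P$. Transitions: $\alpha.F\xrightarrow{\alpha}F$; $!\alpha.F\xrightarrow{\alpha}\ !\alpha.F|F$; if $P_1\xrightarrow{\alpha}P_1'$ then $P_1|P_2\xrightarrow{\alpha}P_1'|P_2$ and $P_2|P_1\xrightarrow{\alpha}P_2|P_1'$. $\sim$ is strong bisimilarity. $\equiv_D$ is the smallest congruence containing the abelian monoid laws for $|$ with neutral $0$ and the distribution law $\alpha.(F|\alpha.F|\cdots|\alpha.F)=\alpha.F|\cdots|\alpha.F$ ($k\ge0$ copies of $\alpha.F$ on the left, $k+1$ on the right). The size of a process is its number of prefixes; a process is a seed if no bisimilar process has strictly smaller size. Write $P\Rightarrow_k Q$ if there are actions $\beta_1,\dots,\beta_k$ and processes $P_0,\dots,P_k$ with $P=P_0\xrightarrow{\beta_1}P_1\cdots\xrightarrow{\beta_k}P_k\equiv_D Q$. For $S=\prod_i!\alpha_i.S_i$ and finite $F$: $S\mathrel{\#}F$ means there are no $i$ and $k\ge0$ with $F\Rightarrow_k \alpha_i.S_i$; $S\rightsquigarrow F$ means there is $k>0$ with $S\Rightarrow_k S|F$. -}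

module Defs where

open import Data.Nat using (ℕ; zero; suc; _+_; _<_)
open import Data.Product using (Σ; _×_; _,_; ∃)
open import Data.List using (List; []; _∷_)
open import Data.List.Membership.Propositional using (_∈_)
open import Data.List.Relation.Unary.All using (All)
open import Relation.Nullary using (¬_)

-- Actions: a countable set, taken to be ℕ.
Act : Set
Act = ℕ

-- Raw process terms; the grammars of the paper are carved out by predicates.
infixr 5 _∣_
data Proc : Set where
  𝟎   : Proc
  _·_ : Act → Proc → Proc
  !_·_ : Act → Proc → Proc
  _∣_ : Proc → Proc → Proc

data Finite : Proc → Set where
  fin-0   : Finite 𝟎
  fin-pre : ∀ {a F} → Finite F → Finite (a · F)
  fin-par : ∀ {F G} → Finite F → Finite G → Finite (F ∣ G)

data IsProc : Proc → Set where
  proc-fin  : ∀ {F} → Finite F → IsProc F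
  proc-bang : ∀ {a F} → Finite F → IsProc (! a · F)
  proc-par  : ∀ {P Q} → IsProc P → IsProc Q → IsProc (P ∣ Q)

data _─[_]→_ : Proc → Act → Proc → Set where
  t-pre  : ∀ {a F} → (a · F) ─[ a ]→ F
  t-rep  : ∀ {a F} → (! a · F) ─[ a ]→ ((! a · F) ∣ F)
  t-parL : ∀ {a P P' Q} → P ─[ a ]→ P' → (P ∣ Q) ─[ a ]→ (P' ∣ Q)
  t-parR : ∀ {a P P' Q} → P ─[ a ]→ P' → (Q ∣ P) ─[ a ]→ (Q ∣ P')

IsBisimulation : (Proc → Proc → Set) → Set
IsBisimulation R = ∀ P Q → R P Q →
    (∀ a P' → P ─[ a ]→ P' → Σ Proc λ Q' → (Q ─[ a ]→ Q') × R P' Q')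
  × (∀ a Q' → Q ─[ a ]→ Q' → Σ Proc λ P' → (P ─[ a ]→ P') × R P' Q')

_∼_ : Proc → Proc → Set₁
P ∼ Q = Σ (Proc → Proc → Set) λ R → IsBisimulation R × R P Q

size : Proc → ℕ
size 𝟎 = 0
size (a · P) = suc (size P)
size (! a · P) = suc (size P)
size (P ∣ Q) = size P + size Q

Seed : Proc → Set₁
Seed P = ∀ Q → IsProc Q → P ∼ Q → ¬ (size Q < size P)

-- G ∣ ... ∣ G  with k+1 copies
copies : ℕ → Proc → Proc
copies zero G = G
copies (suc k) G = copies k G ∣ G

-- F ∣ G ∣ ... ∣ G  with k copies of G
withCopies : Proc → ℕ → Proc → Proc
withCopies F zero G = F
withCopies F (suc k) G = withCopies F k G ∣ G

data _≡D_ : Proc → Proc → Set where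
  d-refl  : ∀ {P} → P ≡D P
  d-sym   : ∀ {P Q} → P ≡D Q → Q ≡D P
  d-trans : ∀ {P Q R} → P ≡D Q → Q ≡D R → P ≡D R
  d-pre   : ∀ {a P Q} → P ≡D Q → (a · P) ≡D (a · Q)
  d-bang  : ∀ {a P Q} → P ≡D Q → (! a · P) ≡D (! a · Q)
  d-par   : ∀ {P P' Q Q'} → P ≡D P' → Q ≡D Q' → (P ∣ Q) ≡D (P' ∣ Q')
  d-comm  : ∀ {P Q} → (P ∣ Q) ≡D (Q ∣ P)
  d-assoc : ∀ {P Q R} → ((P ∣ Q) ∣ R) ≡D (P ∣ (Q ∣ R))
  d-unit  : ∀ {P} → (P ∣ 𝟎) ≡D P
  d-dist  : ∀ {a F} (k : ℕ) → Finite F →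
            (a · withCopies F k (a · F)) ≡D copies k (a · F)

data Steps : ℕ → Proc → Proc → Set where
  s-zero : ∀ {P} → Steps zero P P
  s-suc  : ∀ {k a P P₁ P'} → P ─[ a ]→ P₁ → Steps k P₁ P' → Steps (suc k) P P'

_⇒[_]_ : Proc → ℕ → Proc → Set
P ⇒[ k ] Q = Σ Proc λ Pk → Steps k P Pk × (Pk ≡D Q)

Components : Set
Components = List (Act × Proc)

prodBang : Components → Proc
prodBang [] = 𝟎
prodBang ((a , F) ∷ []) = ! a · F
prodBang ((a , F) ∷ c ∷ cs) = (! a · F) ∣ prodBang (c ∷ cs)

FiniteBodies : Components → Set
FiniteBodies cs = All (λ c → Finite (Data.Product.proj₂ c)) cs

Apart : Components → Proc → Set
Apart cs F = ∀ a Si → (a , Si) ∈ cs → ∀ (k : ℕ) → ¬ (F ⇒[ k ] (a · Si))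

Leadsto : Components → Proc → Set
Leadsto cs F = Σ ℕ λ k → (0 < k) × (prodBang cs ⇒[ k ] (prodBang cs ∣ F))

module Submission where

-- A prefix b.X is absorbable by S = ∏ !αᵢ.Sᵢ when some parallel power of b.X is
-- ≡D-equal to some parallel power of b.Sᵢ with αᵢ = b. Next to S such a prefix can
-- be deleted without changing behaviour: its firing is imitated by S spawning a
-- copy of Sᵢ, and vice versa. Absorbable prefixes are invariant under ≡D, and a
-- transition only discards prefixes, so whatever reaches αᵢ.Sᵢ (itself absorbable)
-- already contains one. For (i), deleting it from F makes S|F smaller; for (ii),
-- R ⇒ αᵢ.Sᵢ and S ⇒ S|R put one in S, hence in some body Sⱼ, and deleting it
-- there makes S smaller. Either way the seed hypothesis is contradicted.

open import Defs
open import Data.Empty using (⊥; ⊥-elim)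
open import Data.List using ([]; _∷_)
open import Data.List.Membership.Propositional using (_∈_)
open import Data.List.Relation.Unary.All using (_∷_; lookup)
open import Data.List.Relation.Unary.Any using (here; there; _∷=_)
open import Data.Nat using (ℕ; zero; suc; _+_; _*_; _<_; z≤n; s≤s)
open import Data.Nat.Properties using (+-monoˡ-<; +-monoʳ-<; +-identityʳ)
open import Data.Nat.Tactic.RingSolver using (solve-∀)
open import Data.Product using (Σ; _×_; _,_; proj₁; proj₂)
open import Data.Sum using (_⊎_; inj₁; inj₂; [_,_]; map; map₁; map₂; swap; assocʳ; assocˡ; fromInj₁)
open import Data.Sum.Function.Propositional using (_⊎-⇔_)
open import Function using (id; _∘_; _⇔_; mk⇔; Equivalence)
open import Function.Properties.Equivalence using ()
  renaming (refl to ⇔-refl; sym to ⇔-sym; trans to ⇔-trans)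
open import Relation.Binary.PropositionalEquality using (_≡_; refl; sym; cong; subst₂)

open Equivalence using (to; from)

≡D-reflexive : ∀ {P Q} → P ≡ Q → P ≡D Q
≡D-reflexive refl = d-refl

∣-identityˡ : ∀ {A} → (𝟎 ∣ A) ≡D A
∣-identityˡ = d-trans d-comm d-unit

∣-swapʳ : ∀ {A B C} → ((A ∣ B) ∣ C) ≡D ((A ∣ C) ∣ B)
∣-swapʳ = d-trans d-assoc (d-trans (d-par d-refl d-comm) (d-sym d-assoc))

∣-assoc-swap : ∀ {A B C} → ((A ∣ B) ∣ C) ≡D (A ∣ (C ∣ B))
∣-assoc-swap = d-trans d-assoc (d-par d-refl d-comm)

copies-cong : ∀ i {X Y} → X ≡D Y → copies i X ≡D copies i Y
copies-cong zero e = e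
copies-cong (suc i) e = d-par (copies-cong i e) e

copies-∣ : ∀ k {Y Z} → (copies k Y ∣ Z) ≡D (withCopies Z k Y ∣ Y)
copies-∣ zero = d-comm
copies-∣ (suc k) = d-trans ∣-swapʳ (d-par (copies-∣ k) d-refl)

copies-+ : ∀ m k {Y} → (copies m Y ∣ copies k Y) ≡D copies (suc k + m) Y
copies-+ m zero = d-refl
copies-+ m (suc k) = d-trans (d-sym d-assoc) (d-par (copies-+ m k) d-refl)

copies-copies : ∀ i k {Y} → copies i (copies k Y) ≡D copies (i * suc k + k) Y
copies-copies zero k = d-refl
copies-copies (suc i) k {Y} =
  d-trans (d-par (copies-copies i k) d-refl)
    (d-trans (copies-+ (i * suc k + k) k) (≡D-reflexive (cong (λ n → copies n Y) (count i k))))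
  where
  count : ∀ i k → suc k + (i * suc k + k) ≡ suc k + i * suc k + k
  count = solve-∀

copies-comm : ∀ i k {Y} → copies i (copies k Y) ≡D copies k (copies i Y)
copies-comm i k {Y} =
  d-trans (copies-copies i k)
    (d-trans (≡D-reflexive (cong (λ n → copies n Y) (count i k))) (d-sym (copies-copies k i)))
  where
  count : ∀ i k → i * suc k + k ≡ k * suc i + i
  count = solve-∀

copies-fire : ∀ {a F} k → copies k (a · F) ─[ a ]→ withCopies F k (a · F)
copies-fire zero = t-pre
copies-fire (suc k) = t-parL (copies-fire k)

copies-step : ∀ {a b F Q} k → copies k (a · F) ─[ b ]→ Q →
              b ≡ a × withCopies F k (a · F) ≡D Q
copies-step zero t-pre = refl , d-refl
copies-step (suc k) (t-parL t) with copies-step k t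
... | refl , e = refl , d-par e d-refl
copies-step (suc k) (t-parR t-pre) = refl , d-sym (copies-∣ k)

≡D-step : ∀ {P Q a P'} → P ≡D Q → P ─[ a ]→ P' →
          Σ Proc λ Q' → Q ─[ a ]→ Q' × P' ≡D Q'
≡D-step⁻ : ∀ {P Q a Q'} → P ≡D Q → Q ─[ a ]→ Q' →
           Σ Proc λ P' → P ─[ a ]→ P' × P' ≡D Q'

≡D-step d-refl t = _ , t , d-refl
≡D-step (d-sym e) t with ≡D-step⁻ e t
... | P' , t' , e' = P' , t' , d-sym e'
≡D-step (d-trans e₁ e₂) t with ≡D-step e₁ t
... | Q₁ , t₁ , e₁' with ≡D-step e₂ t₁
... | Q₂ , t₂ , e₂' = Q₂ , t₂ , d-trans e₁' e₂'
≡D-step (d-pre e) t-pre = _ , t-pre , e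
≡D-step (d-bang e) t-rep = _ , t-rep , d-par (d-bang e) e
≡D-step (d-par e₁ e₂) (t-parL t) with ≡D-step e₁ t
... | _ , t' , e' = _ , t-parL t' , d-par e' e₂
≡D-step (d-par e₁ e₂) (t-parR t) with ≡D-step e₂ t
... | _ , t' , e' = _ , t-parR t' , d-par e₁ e'
≡D-step d-comm (t-parL t) = _ , t-parR t , d-comm
≡D-step d-comm (t-parR t) = _ , t-parL t , d-comm
≡D-step d-assoc (t-parL (t-parL t)) = _ , t-parL t , d-assoc
≡D-step d-assoc (t-parL (t-parR t)) = _ , t-parR (t-parL t) , d-assoc
≡D-step d-assoc (t-parR t) = _ , t-parR (t-parR t) , d-assoc
≡D-step d-unit (t-parL t) = _ , t , d-unit
≡D-step (d-dist k _) t-pre = _ , copies-fire k , d-refl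

≡D-step⁻ d-refl t = _ , t , d-refl
≡D-step⁻ (d-sym e) t with ≡D-step e t
... | Q' , t' , e' = Q' , t' , d-sym e'
≡D-step⁻ (d-trans e₁ e₂) t with ≡D-step⁻ e₂ t
... | P₁ , t₁ , e₂' with ≡D-step⁻ e₁ t₁
... | P₀ , t₀ , e₁' = P₀ , t₀ , d-trans e₁' e₂'
≡D-step⁻ (d-pre e) t-pre = _ , t-pre , e
≡D-step⁻ (d-bang e) t-rep = _ , t-rep , d-par (d-bang e) e
≡D-step⁻ (d-par e₁ e₂) (t-parL t) with ≡D-step⁻ e₁ t
... | _ , t' , e' = _ , t-parL t' , d-par e' e₂
≡D-step⁻ (d-par e₁ e₂) (t-parR t) with ≡D-step⁻ e₂ t
... | _ , t' , e' = _ , t-parR t' , d-par e₁ e'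
≡D-step⁻ d-comm (t-parL t) = _ , t-parR t , d-comm
≡D-step⁻ d-comm (t-parR t) = _ , t-parL t , d-comm
≡D-step⁻ d-assoc (t-parL t) = _ , t-parL (t-parL t) , d-assoc
≡D-step⁻ d-assoc (t-parR (t-parL t)) = _ , t-parL (t-parR t) , d-assoc
≡D-step⁻ d-assoc (t-parR (t-parR t)) = _ , t-parR t , d-assoc
≡D-step⁻ d-unit t = _ , t-parL t , d-unit
≡D-step⁻ (d-dist k _) t with copies-step k t
... | refl , e = _ , t-pre , e

copies-residual : ∀ {b X T} i j → copies i (b · X) ≡D copies j (b · T) →
                  withCopies X i (b · X) ≡D withCopies T j (b · T)
copies-residual i j c with ≡D-step c (copies-fire i)
... | _ , t , e with copies-step j t
... | refl , e' = d-trans e (d-sym e')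

prodBang-step : ∀ ds {a V} → prodBang ds ─[ a ]→ V →
                Σ Proc λ T → (a , T) ∈ ds × V ≡D (prodBang ds ∣ T)
prodBang-step ((_ , T) ∷ []) t-rep = T , here refl , d-refl
prodBang-step ((_ , T) ∷ _ ∷ _) (t-parL t-rep) = T , here refl , ∣-swapʳ
prodBang-step (_ ∷ c ∷ ds) (t-parR t) with prodBang-step (c ∷ ds) t
... | T , m , e = T , there m , d-trans (d-par d-refl e) (d-sym d-assoc)

prodBang-fire : ∀ ds {a T} → (a , T) ∈ ds →
                Σ Proc λ V → prodBang ds ─[ a ]→ V × V ≡D (prodBang ds ∣ T)
prodBang-fire (_ ∷ []) (here refl) = _ , t-rep , d-refl
prodBang-fire (_ ∷ _ ∷ _) (here refl) = _ , t-parL t-rep , ∣-swapʳ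
prodBang-fire (_ ∷ c ∷ ds) (there m) with prodBang-fire (c ∷ ds) m
... | V , t , e = _ , t-parR t , d-trans (d-par d-refl e) (d-sym d-assoc)

prodBang∣-fire : ∀ ds {a T X} → (a , T) ∈ ds →
                 Σ Proc λ A → (prodBang ds ∣ X) ─[ a ]→ A × A ≡D (prodBang ds ∣ (X ∣ T))
prodBang∣-fire ds m with prodBang-fire ds m
... | V , t , e = _ , t-parL t , d-trans (d-par e d-refl) ∣-assoc-swap

prodBang-isProc : ∀ ds → FiniteBodies ds → IsProc (prodBang ds)
prodBang-isProc [] _ = proc-fin fin-0
prodBang-isProc (_ ∷ []) (f ∷ _) = proc-bang f
prodBang-isProc (_ ∷ c ∷ ds) (f ∷ fs) = proc-par (proc-bang f) (prodBang-isProc (c ∷ ds) fs)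

componentsSize : Components → ℕ
componentsSize [] = 0
componentsSize ((_ , T) ∷ ds) = suc (size T) + componentsSize ds

size-prodBang : ∀ ds → size (prodBang ds) ≡ componentsSize ds
size-prodBang [] = refl
size-prodBang ((_ , T) ∷ []) = sym (+-identityʳ (suc (size T)))
size-prodBang ((_ , T) ∷ c ∷ ds) = cong (suc (size T) +_) (size-prodBang (c ∷ ds))

prodBang-∷=-< : ∀ {ds b T Z} (p : (b , T) ∈ ds) → size Z < size T →
                size (prodBang (p ∷= (b , Z))) < size (prodBang ds)
prodBang-∷=-< {ds} {b} {Z = Z} p lt =
  subst₂ _<_ (sym (size-prodBang (p ∷= (b , Z)))) (sym (size-prodBang ds)) (smaller p lt)
  where
  smaller : ∀ {ds b T Z} (p : (b , T) ∈ ds) → size Z < size T →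
            componentsSize (p ∷= (b , Z)) < componentsSize ds
  smaller {_ ∷ ds} (here refl) lt = +-monoˡ-< (componentsSize ds) (s≤s lt)
  smaller {(_ , U) ∷ _} (there p) lt = +-monoʳ-< (suc (size U)) (smaller p lt)

∷=-finiteBodies : ∀ {ds b T Z} (p : (b , T) ∈ ds) → FiniteBodies ds → Finite Z →
                  FiniteBodies (p ∷= (b , Z))
∷=-finiteBodies (here refl) (_ ∷ fs) fZ = fZ ∷ fs
∷=-finiteBodies (there p) (f ∷ fs) fZ = f ∷ ∷=-finiteBodies p fs fZ

infix 4 _≃_

_≃_ : Proc → Proc → Set
P ≃ Q = Σ ℕ λ i → Σ ℕ λ j → copies i P ≡D copies j Q

≃-respˡ : ∀ {P P' Q} → P ≡D P' → P ≃ Q → P' ≃ Q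
≃-respˡ e (i , j , c) = i , j , d-trans (copies-cong i (d-sym e)) c

copies-≃ : ∀ k {P Q} → copies k P ≃ Q ⇔ P ≃ Q
copies-≃ k = mk⇔
  (λ (i , j , c) → i * suc k + k , j , d-trans (d-sym (copies-copies i k)) c)
  (λ (i , j , c) → i , k * suc j + j ,
     d-trans (copies-comm i k) (d-trans (copies-cong k c) (copies-copies k j)))

module Absorption (cs : Components) where

  Absorbable : Act → Proc → Set
  Absorbable b X = Σ Proc λ T → (b , T) ∈ cs × (b · X) ≃ (b · T)

  component-absorbable : ∀ {b T} → (b , T) ∈ cs → Absorbable b T
  component-absorbable m = _ , m , 0 , 0 , d-refl

  absorbable-resp : ∀ {b X Y} → X ≡D Y → Absorbable b X → Absorbable b Y
  absorbable-resp e (T , m , ok) = T , m , ≃-respˡ (d-pre e) ok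

  absorbable-dist : ∀ {a F} k → Finite F → Absorbable a (withCopies F k (a · F)) ⇔ Absorbable a F
  absorbable-dist k f = mk⇔
    (λ (T , m , ok) → T , m , to (copies-≃ k) (≃-respˡ (d-dist k f) ok))
    (λ (T , m , ok) → T , m , ≃-respˡ (d-sym (d-dist k f)) (from (copies-≃ k) ok))

  infix 4 _≈ₐ_
  data _≈ₐ_ : Proc → Proc → Set where
    from-≡D : ∀ {X Y} → X ≡D Y → X ≈ₐ Y
    ≈ₐ-trans : ∀ {X Y Z} → X ≈ₐ Y → Y ≈ₐ Z → X ≈ₐ Z
    ∣-cong : ∀ {X Y Z W} → X ≈ₐ Y → Z ≈ₐ W → (X ∣ Z) ≈ₐ (Y ∣ W)
    ·-cong : ∀ {b X Y} → X ≈ₐ Y → (b · X) ≈ₐ (b · Y)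
    absorb : ∀ {b X} → Absorbable b X → (b · X) ≈ₐ 𝟎
    emit : ∀ {b X} → Absorbable b X → 𝟎 ≈ₐ (b · X)

  ≈ₐ-refl : ∀ {X} → X ≈ₐ X
  ≈ₐ-refl = from-≡D d-refl

  absorb-copies : ∀ {b X} → Absorbable b X → ∀ Z n → withCopies Z n (b · X) ≈ₐ Z
  absorb-copies ok Z zero = ≈ₐ-refl
  absorb-copies ok Z (suc n) = ≈ₐ-trans (∣-cong (absorb-copies ok Z n) (absorb ok)) (from-≡D d-unit)

  emit-copies : ∀ {b X} → Absorbable b X → ∀ Z n → Z ≈ₐ withCopies Z n (b · X)
  emit-copies ok Z zero = ≈ₐ-refl
  emit-copies ok Z (suc n) = ≈ₐ-trans (from-≡D (d-sym d-unit)) (∣-cong (emit-copies ok Z n) (emit ok))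

  -- Pad both sides with absorbable copies until copies-residual applies.
  absorbed-body : ∀ {b X T} (m : (b , T) ∈ cs) → (b · X) ≃ (b · T) → X ≈ₐ T
  absorbed-body {X = X} {T} m (i , j , c) =
    ≈ₐ-trans (emit-copies (T , m , i , j , c) X i)
      (≈ₐ-trans (from-≡D (copies-residual i j c)) (absorb-copies (component-absorbable m) T j))

  absorbed-body⁻ : ∀ {b X T} (m : (b , T) ∈ cs) → (b · X) ≃ (b · T) → T ≈ₐ X
  absorbed-body⁻ {X = X} {T} m (i , j , c) =
    ≈ₐ-trans (emit-copies (component-absorbable m) T j)
      (≈ₐ-trans (from-≡D (d-sym (copies-residual i j c))) (absorb-copies (T , m , i , j , c) X i))

  infix 4 _≈ᶜ_
  _≈ᶜ_ : Components → Components → Set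
  ds ≈ᶜ es = (∀ {a T} → (a , T) ∈ ds → Σ Proc λ T' → (a , T') ∈ es × T ≈ₐ T')
           × (∀ {a T'} → (a , T') ∈ es → Σ Proc λ T → (a , T) ∈ ds × T ≈ₐ T')

  ≈ᶜ-refl : ∀ {ds} → ds ≈ᶜ ds
  ≈ᶜ-refl = (λ m → _ , m , ≈ₐ-refl) , (λ m → _ , m , ≈ₐ-refl)

  ∷=-≈ᶜ : ∀ {ds b T Z} (p : (b , T) ∈ ds) → T ≈ₐ Z → ds ≈ᶜ (p ∷= (b , Z))
  ∷=-≈ᶜ {b = b} {T} {Z} p T≈Z = forth p , back p
    where
    forth : ∀ {ds} (p : (b , T) ∈ ds) {a U} → (a , U) ∈ ds →
            Σ Proc λ U' → (a , U') ∈ (p ∷= (b , Z)) × U ≈ₐ U'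
    forth (here refl) (here refl) = Z , here refl , T≈Z
    forth (here refl) (there q) = _ , there q , ≈ₐ-refl
    forth (there p) (here refl) = _ , here refl , ≈ₐ-refl
    forth (there p) (there q) with forth p q
    ... | U' , q' , e = U' , there q' , e

    back : ∀ {ds} (p : (b , T) ∈ ds) {a U'} → (a , U') ∈ (p ∷= (b , Z)) →
           Σ Proc λ U → (a , U) ∈ ds × U ≈ₐ U'
    back (here refl) (here refl) = T , here refl , T≈Z
    back (here refl) (there q) = _ , there q , ≈ₐ-refl
    back (there p) (here refl) = _ , here refl , ≈ₐ-refl
    back (there p) (there q) with back p q
    ... | U , q' , e = U , there q' , e

  module Bisimulation {cr : Components} (cs≈cr : cs ≈ᶜ cr) where

    -- A step of X that Y cannot follow is the firing of an absorbed prefix; it is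
    -- matched by the context spawning a component body instead.
    ≈ₐ-step : ∀ {X Y a X'} → X ≈ₐ Y → X ─[ a ]→ X' →
              (Σ Proc λ Y' → Y ─[ a ]→ Y' × X' ≈ₐ Y')
              ⊎ (Σ Proc λ T' → (a , T') ∈ cr × X' ≈ₐ (Y ∣ T'))
    ≈ₐ-step (from-≡D e) t with ≡D-step e t
    ... | Y' , t' , e' = inj₁ (Y' , t' , from-≡D e')
    ≈ₐ-step (≈ₐ-trans e₁ e₂) t with ≈ₐ-step e₁ t
    ... | inj₂ (T' , m , e₁') = inj₂ (T' , m , ≈ₐ-trans e₁' (∣-cong e₂ ≈ₐ-refl))
    ... | inj₁ (Y₁ , t₁ , e₁') with ≈ₐ-step e₂ t₁
    ...   | inj₁ (Y₂ , t₂ , e₂') = inj₁ (Y₂ , t₂ , ≈ₐ-trans e₁' e₂')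
    ...   | inj₂ (T' , m , e₂') = inj₂ (T' , m , ≈ₐ-trans e₁' e₂')
    ≈ₐ-step (∣-cong e₁ e₂) (t-parL t) with ≈ₐ-step e₁ t
    ... | inj₁ (Y' , t' , e') = inj₁ (_ , t-parL t' , ∣-cong e' e₂)
    ... | inj₂ (T' , m , e') = inj₂ (T' , m , ≈ₐ-trans (∣-cong e' e₂) (from-≡D ∣-swapʳ))
    ≈ₐ-step (∣-cong e₁ e₂) (t-parR t) with ≈ₐ-step e₂ t
    ... | inj₁ (Y' , t' , e') = inj₁ (_ , t-parR t' , ∣-cong e₁ e')
    ... | inj₂ (T' , m , e') = inj₂ (T' , m , ≈ₐ-trans (∣-cong e₁ e') (from-≡D (d-sym d-assoc)))
    ≈ₐ-step (·-cong e) t-pre = inj₁ (_ , t-pre , e)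
    ≈ₐ-step (absorb (T , m , ok)) t-pre with proj₁ cs≈cr m
    ... | T' , m' , T≈T' =
      inj₂ (T' , m' , ≈ₐ-trans (absorbed-body m ok) (≈ₐ-trans T≈T' (from-≡D (d-sym ∣-identityˡ))))

    ≈ₐ-step⁻ : ∀ {X Y a Y'} → X ≈ₐ Y → Y ─[ a ]→ Y' →
               (Σ Proc λ X' → X ─[ a ]→ X' × X' ≈ₐ Y')
               ⊎ (Σ Proc λ T → (a , T) ∈ cs × (X ∣ T) ≈ₐ Y')
    ≈ₐ-step⁻ (from-≡D e) t with ≡D-step⁻ e t
    ... | X' , t' , e' = inj₁ (X' , t' , from-≡D e')
    ≈ₐ-step⁻ (≈ₐ-trans e₁ e₂) t with ≈ₐ-step⁻ e₂ t
    ... | inj₂ (T , m , e₂') = inj₂ (T , m , ≈ₐ-trans (∣-cong e₁ ≈ₐ-refl) e₂')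
    ... | inj₁ (Y₁ , t₁ , e₂') with ≈ₐ-step⁻ e₁ t₁
    ...   | inj₁ (X₀ , t₀ , e₁') = inj₁ (X₀ , t₀ , ≈ₐ-trans e₁' e₂')
    ...   | inj₂ (T , m , e₁') = inj₂ (T , m , ≈ₐ-trans e₁' e₂')
    ≈ₐ-step⁻ (∣-cong e₁ e₂) (t-parL t) with ≈ₐ-step⁻ e₁ t
    ... | inj₁ (X' , t' , e') = inj₁ (_ , t-parL t' , ∣-cong e' e₂)
    ... | inj₂ (T , m , e') = inj₂ (T , m , ≈ₐ-trans (from-≡D ∣-swapʳ) (∣-cong e' e₂))
    ≈ₐ-step⁻ (∣-cong e₁ e₂) (t-parR t) with ≈ₐ-step⁻ e₂ t
    ... | inj₁ (X' , t' , e') = inj₁ (_ , t-parR t' , ∣-cong e₁ e')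
    ... | inj₂ (T , m , e') = inj₂ (T , m , ≈ₐ-trans (from-≡D d-assoc) (∣-cong e₁ e'))
    ≈ₐ-step⁻ (·-cong e) t-pre = inj₁ (_ , t-pre , e)
    ≈ₐ-step⁻ (emit (T , m , ok)) t-pre =
      inj₂ (T , m , ≈ₐ-trans (from-≡D ∣-identityˡ) (absorbed-body⁻ m ok))

    S S' : Proc
    S = prodBang cs
    S' = prodBang cr

    Related : Proc → Proc → Set
    Related A B = Σ Proc λ X → Σ Proc λ Y → X ≈ₐ Y × A ≡D (S ∣ X) × B ≡D (S' ∣ Y)

    context-step : ∀ {X Y a A} → X ≈ₐ Y → (S ∣ X) ─[ a ]→ A →
                   Σ Proc λ B → (S' ∣ Y) ─[ a ]→ B × Related A B
    context-step {X} {Y} e (t-parL t) with prodBang-step cs t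
    ... | T , m , eV with proj₁ cs≈cr m
    ... | T' , m' , T≈T' with prodBang∣-fire cr m'
    ... | B , u , eB =
      B , u , X ∣ T , Y ∣ T' , ∣-cong e T≈T' , d-trans (d-par eV d-refl) ∣-assoc-swap , eB
    context-step {Y = Y} e (t-parR t) with ≈ₐ-step e t
    ... | inj₁ (Y' , u , e') = _ , t-parR u , _ , Y' , e' , d-refl , d-refl
    ... | inj₂ (T' , m' , e') with prodBang∣-fire cr m'
    ... | B , u , eB = B , u , _ , Y ∣ T' , e' , d-refl , eB

    context-step⁻ : ∀ {X Y a B} → X ≈ₐ Y → (S' ∣ Y) ─[ a ]→ B →
                    Σ Proc λ A → (S ∣ X) ─[ a ]→ A × Related A B
    context-step⁻ {X} {Y} e (t-parL u) with prodBang-step cr u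
    ... | T' , m' , eV with proj₂ cs≈cr m'
    ... | T , m , T≈T' with prodBang∣-fire cs m
    ... | A , t , eA =
      A , t , X ∣ T , Y ∣ T' , ∣-cong e T≈T' , eA , d-trans (d-par eV d-refl) ∣-assoc-swap
    context-step⁻ {X} e (t-parR u) with ≈ₐ-step⁻ e u
    ... | inj₁ (X' , t , e') = _ , t-parR t , X' , _ , e' , d-refl , d-refl
    ... | inj₂ (T , m , e') with prodBang∣-fire cs m
    ... | A , t , eA = A , t , X ∣ T , _ , e' , eA , d-refl

    related-step : ∀ {A B a A'} → Related A B → A ─[ a ]→ A' →
                   Σ Proc λ B' → B ─[ a ]→ B' × Related A' B'
    related-step (X , Y , e , eA , eB) t with ≡D-step eA t
    ... | _ , t₀ , eA₀ with context-step e t₀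
    ... | _ , u₀ , X' , Y' , e' , eX' , eY' with ≡D-step⁻ eB u₀
    ... | B' , u , eB' = B' , u , X' , Y' , e' , d-trans eA₀ eX' , d-trans eB' eY'

    related-step⁻ : ∀ {A B a B'} → Related A B → B ─[ a ]→ B' →
                    Σ Proc λ A' → A ─[ a ]→ A' × Related A' B'
    related-step⁻ (X , Y , e , eA , eB) u with ≡D-step eB u
    ... | _ , u₀ , eB₀ with context-step⁻ e u₀
    ... | _ , t₀ , X' , Y' , e' , eX' , eY' with ≡D-step⁻ eA t₀
    ... | A' , t , eA' = A' , t , X' , Y' , e' , d-trans eA' eX' , d-trans eB₀ eY'

    related-isBisimulation : IsBisimulation Related
    related-isBisimulation _ _ r = (λ _ _ → related-step r) , (λ _ _ → related-step⁻ r)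

    ∣-∼ : ∀ {X Y} → X ≈ₐ Y → (S ∣ X) ∼ (S' ∣ Y)
    ∣-∼ e = Related , related-isBisimulation , _ , _ , e , d-refl , d-refl

    prodBang-∼ : S ∼ S'
    prodBang-∼ = Related , related-isBisimulation , 𝟎 , 𝟎 , ≈ₐ-refl , d-sym d-unit , d-sym d-unit

  -- Replicated prefixes do not count: only plain prefixes can be absorbed.
  HasAbsorbable : Proc → Set
  HasAbsorbable 𝟎 = ⊥
  HasAbsorbable (b · X) = Absorbable b X ⊎ HasAbsorbable X
  HasAbsorbable (! _ · X) = HasAbsorbable X
  HasAbsorbable (P ∣ Q) = HasAbsorbable P ⊎ HasAbsorbable Q

  has-copies : ∀ k {P} → HasAbsorbable (copies k P) ⇔ HasAbsorbable P
  has-copies zero = ⇔-refl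
  has-copies (suc k) = mk⇔ [ to (has-copies k) , id ] inj₂

  has-withCopies : ∀ k {Q P} → HasAbsorbable (withCopies Q k P) → HasAbsorbable Q ⊎ HasAbsorbable P
  has-withCopies zero = inj₁
  has-withCopies (suc k) = [ has-withCopies k , inj₂ ]

  has-withCopies⁺ : ∀ k {Q P} → HasAbsorbable Q → HasAbsorbable (withCopies Q k P)
  has-withCopies⁺ zero = id
  has-withCopies⁺ (suc k) = inj₁ ∘ has-withCopies⁺ k

  has-cong : ∀ {P Q} → P ≡D Q → HasAbsorbable P ⇔ HasAbsorbable Q
  has-cong d-refl = ⇔-refl
  has-cong (d-sym e) = ⇔-sym (has-cong e)
  has-cong (d-trans e₁ e₂) = ⇔-trans (has-cong e₁) (has-cong e₂)
  has-cong (d-pre e) = mk⇔ (absorbable-resp e) (absorbable-resp (d-sym e)) ⊎-⇔ has-cong e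
  has-cong (d-bang e) = has-cong e
  has-cong (d-par e₁ e₂) = has-cong e₁ ⊎-⇔ has-cong e₂
  has-cong d-comm = mk⇔ swap swap
  has-cong d-assoc = mk⇔ assocʳ assocˡ
  has-cong d-unit = mk⇔ (fromInj₁ ⊥-elim) inj₁
  has-cong (d-dist k f) = mk⇔
    [ into ∘ inj₁ ∘ to (absorbable-dist k f) , into ∘ [ inj₂ , id ] ∘ has-withCopies k ]
    (map (from (absorbable-dist k f)) (has-withCopies⁺ k) ∘ to (has-copies k))
    where
    into = from (has-copies k)

  step-reflects : ∀ {P a P'} → P ─[ a ]→ P' → HasAbsorbable P' → HasAbsorbable P
  step-reflects t-pre = inj₂
  step-reflects t-rep = [ id , id ]
  step-reflects (t-parL t) = map₁ (step-reflects t)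
  step-reflects (t-parR t) = map₂ (step-reflects t)

  steps-reflect : ∀ {k P Q} → Steps k P Q → HasAbsorbable Q → HasAbsorbable P
  steps-reflect s-zero = id
  steps-reflect (s-suc t s) = step-reflects t ∘ steps-reflect s

  ⇒-reflects : ∀ {k P Q} → P ⇒[ k ] Q → HasAbsorbable Q → HasAbsorbable P
  ⇒-reflects (_ , s , e) = steps-reflect s ∘ from (has-cong e)

  ⇒-component : ∀ {k P a T} → (a , T) ∈ cs → P ⇒[ k ] (a · T) → HasAbsorbable P
  ⇒-component m r = ⇒-reflects r (inj₁ (component-absorbable m))

  has-prodBang : ∀ ds → HasAbsorbable (prodBang ds) →
                 Σ (Act × Proc) λ c → c ∈ ds × HasAbsorbable (proj₂ c)
  has-prodBang (c ∷ []) h = c , here refl , h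
  has-prodBang (c ∷ d ∷ ds) (inj₁ h) = c , here refl , h
  has-prodBang (c ∷ d ∷ ds) (inj₂ h) with has-prodBang (d ∷ ds) h
  ... | c' , m , h' = c' , there m , h'

  shrink : ∀ {P} → Finite P → HasAbsorbable P →
           Σ Proc λ P' → Finite P' × size P' < size P × P ≈ₐ P'
  shrink (fin-pre f) (inj₁ ok) = 𝟎 , fin-0 , s≤s z≤n , absorb ok
  shrink (fin-pre f) (inj₂ h) with shrink f h
  ... | X' , f' , lt , e = _ , fin-pre f' , s≤s lt , ·-cong e
  shrink (fin-par {G = G} f g) (inj₁ h) with shrink f h
  ... | X' , f' , lt , e = X' ∣ G , fin-par f' g , +-monoˡ-< (size G) lt , ∣-cong e ≈ₐ-refl
  shrink (fin-par {F} f g) (inj₂ h) with shrink g h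
  ... | X' , g' , lt , e = F ∣ X' , fin-par f g' , +-monoʳ-< (size F) lt , ∣-cong ≈ₐ-refl e

module _ (cs : Components) (fb : FiniteBodies cs) where
  open Absorption cs

  seed∣⇒apart : (F : Proc) → Finite F → Seed (prodBang cs ∣ F) → Apart cs F
  seed∣⇒apart F fF seed _ _ m _ F⇒aSi with shrink fF (⇒-component m F⇒aSi)
  ... | F' , fF' , F'<F , F≈F' =
    seed (prodBang cs ∣ F') (proc-par (prodBang-isProc cs fb) (proc-fin fF'))
      (Bisimulation.∣-∼ ≈ᶜ-refl F≈F') (+-monoʳ-< (size (prodBang cs)) F'<F)

  seed⇒leadsto⇒apart : Seed (prodBang cs) → (R : Proc) → Finite R → Leadsto cs R → Apart cs R
  seed⇒leadsto⇒apart seed R _ (_ , _ , S⇒S∣R) _ _ m _ R⇒aSi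
    with has-prodBang cs (⇒-reflects S⇒S∣R (inj₂ (⇒-component m R⇒aSi)))
  ... | (b , T) , p , hT with shrink (lookup fb p) hT
  ... | Z , fZ , Z<T , T≈Z =
    seed (prodBang (p ∷= (b , Z))) (prodBang-isProc _ (∷=-finiteBodies p fb fZ))
      (Bisimulation.prodBang-∼ (∷=-≈ᶜ p T≈Z)) (prodBang-∷=-< p Z<T)

lemma3 : (cs : Components) → FiniteBodies cs → Seed (prodBang cs) →
    ((F : Proc) → Finite F → Seed (prodBang cs ∣ F) → Apart cs F)
    × ((R : Proc) → Finite R → Leadsto cs R → Apart cs R)
lemma3 cs fb seed = seed∣⇒apart cs fb , seed⇒leadsto⇒apart cs fb seed
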